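{- Let $\mathfrak L$ and $\mathfrak L'$ be languages with value domains $\mathbb V$ and $\mathbb V'$, let $\sim$ be an equivalence relation on a class $\mathbb Z\supseteq\mathbb V\cup\mathbb V'$, and let $\mathcal T:\mathbb T_{\mathfrak L}\to\mathbb T_{\mathfrak L'}$ be a translation from $\mathfrak L$ into $\mathfrak L'$ such that $\sim$ is a congruence for $\mathcal T(\mathfrak L)$. If $\mathcal T$ is valid up to $\sim$, then $\mathcal T$ is correct up to $\sim$.
   Context: Fix a set $\mathcal V$ of variables. A language $\mathfrak L$ consists of a set $\mathbb T_{\mathfrak L}$ of expressions built from variables in $\mathcal V$ by operators (and possibly variable-binding recursion constructs), a domain of values $\mathbb V$, and a semantic mapping $[\![\cdot]\!]_{\mathfrak L}:\mathbb T_{\mathfrak L}\to((\mathcal V\to\mathbb V)\to\mathbb V)$; a function $\rho:\mathcal V\to\mathbb V$ is a valuation. Substitutions $\sigma:\mathcal V\rightharpoonup\mathbb T_{\mathfrak L}$ (extended by $\sigma(Y)=Y$ outside the domain) act on terms by capture-avoiding replacement of free variables, written $E[\sigma]$; $\stackrel{\alpha}{=}$ is equality up to renaming of bound variables. The semantics satisfies $[\![E[\sigma]]\!]_{\mathfrak L}(\rho)=[\![E]\!]_{\mathfrak L}([\![\sigma]\!]_{\mathfrak L}(\rho))$, where $[\![\sigma]\!]_{\mathfrak L}(\rho)$ is the valuation $X\mapsto[\![\sigma(X)]\!]_{\mathfrak L}(\rho)$, and $\alpha$-equal terms have equal meaning. A closed expression is one with no free variables; its meaning $[\![P]\!]_{\mathfrak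 L}(\rho)$ does not depend on $\rho$ and is written $[\![P]\!]_{\mathfrak L}$; $\mathcal T_{\mathfrak L}$ denotes the set of closed expressions of $\mathfrak L$. Valuations $\eta,\rho:\mathcal V\to\mathbb Z$ are $\sim$-equivalent, $\eta\sim\rho$, if $\eta(X)\sim\rho(X)$ for all $X$. Let $\mathbb U:=\{v'\in\mathbb V'\mid\exists v\in\mathbb V.\ v'\sim v\}$. A translation $\mathcal T$ is correct up to $\sim$ if (i) for every $v\in\mathbb V$ there is $v'\in\mathbb V'$ with $v'\sim v$, and (ii) $[\![\mathcal T(E)]\!]_{\mathfrak L'}(\eta)\sim[\![E]\!]_{\mathfrak L}(\rho)$ for all $E\in\mathbb T_{\mathfrak L}$ and all valuations $\eta:\mathcal V\to\mathbb V'$, $\rho:\mathcal V\to\mathbb V$ with $\eta\sim\rho$. $\sim$ is a congruence for $\mathcal T(\mathfrak L)$ if $[\![\mathcal T(E)]\!]_{\mathfrak L'}(\nu)\sim[\![\mathcal T(E)]\!]_{\mathfrak L'}(\eta)$ for all $E\in\mathbb T_{\mathfrak L}$ and all $\nu,\eta:\mathcal V\to\mathbb U$ with $\nu\sim\eta$. $\mathcal T$ respects $\sim$ if (i) above holds and $[\![\mathcal T(P)]\!]_{\mathfrak L'}(\eta)\sim[\![P]\!]_{\mathfrak L}$ for all closed $P\in\mathcal T_{\mathfrak L}$ and all valuations $\eta:\mathcal V\to\mathbb U$. $\mathcal T$ is compositional if $\mathcal T(X)=X$ for all $X\in\mathcal V$ and $\mathcal T(E[\sigma])\stackrel{\alpha}{=}\mathcal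 T(E)[\mathcal T\circ\sigma]$ for all $E$ and substitutions $\sigma$. $\mathcal T$ is valid up to $\sim$ if it is compositional, respects $\sim$, and $\mathfrak L$ satisfies: for every $v\in\mathbb V$ there is a closed $P\in\mathcal T_{\mathfrak L}$ with $[\![P]\!]_{\mathfrak L}=v$. -}

module Defs where

open import Level using (0ℓ)
open import Data.Product using (Σ; Σ-syntax; _×_; _,_)
open import Relation.Nullary using (¬_)
open import Relation.Binary.PropositionalEquality using (_≡_)
open import Relation.Binary using (IsEquivalence)

-- Substitutions are total maps 𝒱 → Term (a partial substitution σ is
-- identified with its extension by σ(Y) = Y outside its domain).
-- Substitution  E [ σ ]  is the (capture-avoiding) replacement of free
-- variables; _≈α_ is α-equality; FV E X means "X occurs free in E".
record Language (𝒱 : Set) : Set₁ where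
  field
    Term  : Set
    Val   : Set
    var   : 𝒱 → Term
    _[_]  : Term → (𝒱 → Term) → Term
    _≈α_  : Term → Term → Set
    FV    : Term → 𝒱 → Set
    ⟦_⟧   : Term → (𝒱 → Val) → Val
    subst-var : ∀ X (σ : 𝒱 → Term) → (var X) [ σ ] ≡ σ X
    fv-var    : ∀ X Y → FV (var X) Y → X ≡ Y
    fv-subst  : ∀ E (σ : 𝒱 → Term) Y → FV (E [ σ ]) Y →
                Σ[ X ∈ 𝒱 ] (FV E X × FV (σ X) Y)
    sem-var   : ∀ X ρ → ⟦ var X ⟧ ρ ≡ ρ X
    sem-subst : ∀ E (σ : 𝒱 → Term) ρ →
                ⟦ E [ σ ] ⟧ ρ ≡ ⟦ E ⟧ (λ X → ⟦ σ X ⟧ ρ)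
    sem-α     : ∀ E F ρ → E ≈α F → ⟦ E ⟧ ρ ≡ ⟦ F ⟧ ρ
    -- meanings depend on valuations only pointwise (valuations are
    -- functions; this stands in for function extensionality)
    sem-ext   : ∀ E ρ ρ' → (∀ X → ρ X ≡ ρ' X) → ⟦ E ⟧ ρ ≡ ⟦ E ⟧ ρ'

  Closed : Term → Set
  Closed E = ∀ X → ¬ FV E X

  field
    sem-closed : ∀ P → Closed P → ∀ ρ ρ' → ⟦ P ⟧ ρ ≡ ⟦ P ⟧ ρ'

  _denotes_ : Term → Val → Set
  P denotes v = ∀ ρ → ⟦ P ⟧ ρ ≡ v

-- The setting: languages L, L' over 𝒱, a class Z containing both value
-- domains (via the inclusions ι : Val L → Z, ι' : Val L' → Z), an
-- equivalence relation ∼ on Z, and a translation T.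
module Translation {𝒱 : Set} (L L' : Language 𝒱)
  (Z : Set) (ι : Language.Val L → Z) (ι' : Language.Val L' → Z)
  (_∼_ : Z → Z → Set) (∼-equiv : IsEquivalence _∼_)
  (T : Language.Term L → Language.Term L') where

  private
    module A = Language L
    module B = Language L'

  _∼'_ : B.Val → A.Val → Set
  v' ∼' v = ι' v' ∼ ι v

  InU : B.Val → Set
  InU v' = Σ[ v ∈ A.Val ] (v' ∼' v)

  Covers : Set
  Covers = ∀ (v : A.Val) → Σ[ v' ∈ B.Val ] (v' ∼' v)

  CorrectUpTo : Set
  CorrectUpTo =
    Covers ×
    (∀ (E : A.Term) (η : 𝒱 → B.Val) (ρ : 𝒱 → A.Val) →
       (∀ X → η X ∼' ρ X) →
       B.⟦ T E ⟧ η ∼' A.⟦ E ⟧ ρ)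

  CongruenceFor : Set
  CongruenceFor =
    ∀ (E : A.Term) (ν η : 𝒱 → B.Val) →
      (∀ X → InU (ν X)) → (∀ X → InU (η X)) →
      (∀ X → ι' (ν X) ∼ ι' (η X)) →
      ι' (B.⟦ T E ⟧ ν) ∼ ι' (B.⟦ T E ⟧ η)

  Respects : Set
  Respects =
    Covers ×
    (∀ (P : A.Term) → A.Closed P → ∀ (v : A.Val) → P A.denotes v →
       ∀ (η : 𝒱 → B.Val) → (∀ X → InU (η X)) →
       B.⟦ T P ⟧ η ∼' v)

  Compositional : Set
  Compositional =
    (∀ X → T (A.var X) ≡ B.var X) ×
    (∀ (E : A.Term) (σ : 𝒱 → A.Term) →
       T (E A.[ σ ]) B.≈α (T E B.[ (λ X → T (σ X)) ]))

  Expressive : Set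
  Expressive = ∀ (v : A.Val) → Σ[ P ∈ A.Term ] (A.Closed P × P A.denotes v)

  ValidUpTo : Set
  ValidUpTo = Compositional × Respects × Expressive

module Submission where

-- Proof idea: interpret a valuation ρ by closed expressions σ X denoting ρ X
-- (expressiveness). Then E[σ] is closed and denotes ⟦E⟧ρ, so by respect
-- ⟦T(E[σ])⟧η ∼ ⟦E⟧ρ. Compositionality rewrites ⟦T(E[σ])⟧η as ⟦T E⟧ν with
-- ν X = ⟦T(σ X)⟧η, and respect again gives ν X ∼ ρ X ∼ η X; the congruence
-- property bridges ⟦T E⟧η ∼ ⟦T E⟧ν.

open import Defs
open import Data.Product using (_,_; proj₁; proj₂)
open import Relation.Binary using (IsEquivalence)
open import Relation.Binary.PropositionalEquality using (_≡_; subst; module ≡-Reasoning)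

module _ {𝒱 : Set} (L : Language 𝒱) where
  open Language L

  closed-subst : ∀ E (σ : 𝒱 → Term) → (∀ X → Closed (σ X)) → Closed (E [ σ ])
  closed-subst E σ σ-closed Y Y∈E[σ] with fv-subst E σ Y Y∈E[σ]
  ... | X , _ , Y∈σX = σ-closed X Y Y∈σX

  denotes-subst : ∀ E (σ : 𝒱 → Term) (ρ : 𝒱 → Val) →
                  (∀ X → σ X denotes ρ X) → (E [ σ ]) denotes ⟦ E ⟧ ρ
  denotes-subst E σ ρ σ-denotes ρ' = begin
    ⟦ E [ σ ] ⟧ ρ'            ≡⟨ sem-subst E σ ρ' ⟩
    ⟦ E ⟧ (λ X → ⟦ σ X ⟧ ρ')  ≡⟨ sem-ext E _ ρ (λ X → σ-denotes X ρ') ⟩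
    ⟦ E ⟧ ρ                   ∎
    where open ≡-Reasoning

module _ {𝒱 : Set} (L L' : Language 𝒱)
  (Z : Set) (ι : Language.Val L → Z) (ι' : Language.Val L' → Z)
  (_∼_ : Z → Z → Set) (∼-equiv : IsEquivalence _∼_)
  (T : Language.Term L → Language.Term L') where

  private
    module A = Language L
    module B = Language L'
  open Translation L L' Z ι ι' _∼_ ∼-equiv T
  open IsEquivalence ∼-equiv

  sem-translate-subst : Compositional → ∀ E (σ : 𝒱 → A.Term) η →
                        B.⟦ T (E A.[ σ ]) ⟧ η ≡ B.⟦ T E ⟧ (λ X → B.⟦ T (σ X) ⟧ η)
  sem-translate-subst (_ , T-subst) E σ η = begin
    B.⟦ T (E A.[ σ ]) ⟧ η               ≡⟨ B.sem-α _ _ η (T-subst E σ) ⟩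
    B.⟦ T E B.[ (λ X → T (σ X)) ] ⟧ η   ≡⟨ B.sem-subst (T E) _ η ⟩
    B.⟦ T E ⟧ (λ X → B.⟦ T (σ X) ⟧ η)   ∎
    where open ≡-Reasoning

  correct-on : CongruenceFor → ValidUpTo →
               ∀ E (η : 𝒱 → B.Val) (ρ : 𝒱 → A.Val) →
               (∀ X → η X ∼' ρ X) → B.⟦ T E ⟧ η ∼' A.⟦ E ⟧ ρ
  correct-on congruence (compositional , (_ , respects) , expressive) E η ρ η∼ρ =
    trans ⟦TE⟧η∼⟦TE⟧ν (subst (_∼' A.⟦ E ⟧ ρ) ⟦TE[σ]⟧η≡⟦TE⟧ν ⟦TE[σ]⟧η∼⟦E⟧ρ)
    where
      σ : 𝒱 → A.Term
      σ X = proj₁ (expressive (ρ X))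

      σ-closed : ∀ X → A.Closed (σ X)
      σ-closed X = proj₁ (proj₂ (expressive (ρ X)))

      σ-denotes : ∀ X → σ X A.denotes ρ X
      σ-denotes X = proj₂ (proj₂ (expressive (ρ X)))

      η∈U : ∀ X → InU (η X)
      η∈U X = ρ X , η∼ρ X

      ν : 𝒱 → B.Val
      ν X = B.⟦ T (σ X) ⟧ η

      ν∼ρ : ∀ X → ν X ∼' ρ X
      ν∼ρ X = respects (σ X) (σ-closed X) (ρ X) (σ-denotes X) η η∈U

      ⟦TE[σ]⟧η∼⟦E⟧ρ : B.⟦ T (E A.[ σ ]) ⟧ η ∼' A.⟦ E ⟧ ρ
      ⟦TE[σ]⟧η∼⟦E⟧ρ = respects (E A.[ σ ]) (closed-subst L E σ σ-closed)
                         (A.⟦ E ⟧ ρ) (denotes-subst L E σ ρ σ-denotes) η η∈U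

      ⟦TE[σ]⟧η≡⟦TE⟧ν : B.⟦ T (E A.[ σ ]) ⟧ η ≡ B.⟦ T E ⟧ ν
      ⟦TE[σ]⟧η≡⟦TE⟧ν = sem-translate-subst compositional E σ η

      ⟦TE⟧η∼⟦TE⟧ν : ι' (B.⟦ T E ⟧ η) ∼ ι' (B.⟦ T E ⟧ ν)
      ⟦TE⟧η∼⟦TE⟧ν = congruence E η ν η∈U (λ X → ρ X , ν∼ρ X)
                       (λ X → trans (η∼ρ X) (sym (ν∼ρ X)))

theorem4 : {𝒱 : Set} (L L' : Language 𝒱) (Z : Set)
           (ι : Language.Val L → Z) (ι' : Language.Val L' → Z)
           (_∼_ : Z → Z → Set) (∼-equiv : IsEquivalence _∼_)
           (T : Language.Term L → Language.Term L') →
           Translation.CongruenceFor L L' Z ι ι' _∼_ ∼-equiv T →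
           Translation.ValidUpTo L L' Z ι ι' _∼_ ∼-equiv T →
           Translation.CorrectUpTo L L' Z ι ι' _∼_ ∼-equiv T
theorem4 L L' Z ι ι' _∼_ ∼-equiv T congruence valid@(_ , (covers , _) , _) =
  covers , correct-on L L' Z ι ι' _∼_ ∼-equiv T congruence valid
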